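{- Let $n \geq 4$, $3 \leq c \leq n-1$ and $1 \leq k \leq n-1$ with $k \neq n/2$ be integers. The Nest graph $\Gamma = \mathcal{N}(n;1,2,c;k)$ is edge-transitive with every edge lying on exactly two $3$-cycles if and only if $\Gamma \cong \mathcal{N}(8;1,2,5;3)$; moreover this graph is arc-transitive.
   Context: For integers $n \geq 4$ and $1 \leq a,b,c,k \leq n-1$ with $k \neq n/2$ and $a,b,c$ pairwise distinct, the Nest graph $\mathcal{N}(n;a,b,c;k)$ is the graph with vertex set $\{u_i : i \in \mathbb{Z}_n\} \cup \{v_i : i \in \mathbb{Z}_n\}$ and edges $u_iu_{i+1}$, $v_iv_{i+k}$, $u_iv_i$, $u_iv_{i+a}$, $u_iv_{i+b}$, $u_iv_{i+c}$ for $i \in \mathbb{Z}_n$ (indices modulo $n$). Edge-/arc-transitive means the automorphism group acts transitively on edges/arcs. -}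

module Defs where

open import Data.Nat using (ℕ; _+_; _*_)
open import Data.Fin using (Fin; toℕ)
open import Data.Product using (Σ; ∃; ∃-syntax; _×_; _,_)
open import Data.Sum using (_⊎_)
open import Data.Empty using (⊥)
open import Relation.Nullary using (¬_)
open import Relation.Binary.PropositionalEquality using (_≡_)
open import Function.Bundles using (_↔_; Inverse)

ModEq : ℕ → ℕ → ℕ → Set
ModEq n x y = ∃[ q ] (x ≡ y + q * n ⊎ y ≡ x + q * n)

data Vtx (n : ℕ) : Set where
  u : Fin n → Vtx n
  v : Fin n → Vtx n

NestE : (n a b c k : ℕ) → Vtx n → Vtx n → Set
NestE n a b c k (u i) (u j) = ModEq n (toℕ i + 1) (toℕ j)
NestE n a b c k (v i) (v j) = ModEq n (toℕ i + k) (toℕ j)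
NestE n a b c k (u i) (v j) =
  ModEq n (toℕ i) (toℕ j) ⊎ ModEq n (toℕ i + a) (toℕ j)
    ⊎ ModEq n (toℕ i + b) (toℕ j) ⊎ ModEq n (toℕ i + c) (toℕ j)
NestE n a b c k (v i) (u j) = ⊥

NestAdj : (n a b c k : ℕ) → Vtx n → Vtx n → Set
NestAdj n a b c k x y = NestE n a b c k x y ⊎ NestE n a b c k y x

record Automorphism {V : Set} (Adj : V → V → Set) : Set where
  field
    perm : V ↔ V
    preserves : ∀ x y → Adj x y → Adj (Inverse.to perm x) (Inverse.to perm y)
    reflects : ∀ x y → Adj (Inverse.to perm x) (Inverse.to perm y) → Adj x y

open Automorphism public

EdgeTransitive : {V : Set} → (V → V → Set) → Set
EdgeTransitive {V} Adj = ∀ x y x′ y′ → Adj x y → Adj x′ y′ →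
  ∃[ σ ] let f = Inverse.to (perm {Adj = Adj} σ) in
    (f x ≡ x′ × f y ≡ y′) ⊎ (f x ≡ y′ × f y ≡ x′)

ArcTransitive : {V : Set} → (V → V → Set) → Set
ArcTransitive {V} Adj = ∀ x y x′ y′ → Adj x y → Adj x′ y′ →
  ∃[ σ ] let f = Inverse.to (perm {Adj = Adj} σ) in (f x ≡ x′ × f y ≡ y′)

-- Every edge lies on exactly two 3-cycles, i.e. each edge xy has exactly
-- two common neighbours z (the 3-cycles through xy are x y z).
EveryEdgeOnExactlyTwoTriangles : {V : Set} → (V → V → Set) → Set
EveryEdgeOnExactlyTwoTriangles {V} Adj = ∀ x y → Adj x y →
  ∃[ z₁ ] ∃[ z₂ ] (¬ z₁ ≡ z₂ × Adj x z₁ × Adj y z₁ × Adj x z₂ × Adj y z₂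
    × (∀ z → Adj x z → Adj y z → z ≡ z₁ ⊎ z ≡ z₂))

record Isomorphic {V W : Set} (A : V → V → Set) (B : W → W → Set) : Set where
  field
    iso : V ↔ W
    preserves : ∀ x y → A x y → B (Inverse.to iso x) (Inverse.to iso y)
    reflects : ∀ x y → B (Inverse.to iso x) (Inverse.to iso y) → A x y

-- Write u_i, v_i for the vertices of Γ = N(n;1,2,c;k). Suppose every edge lies on exactly two
-- triangles. The edge u₀u₁ then forces c ≠ 3 and c + 1 ≠ n, and the edge u₀v₁ forces v₁ ≁ v_c;
-- after that only v₀ and v₂ can be common neighbours of u₀ and v_c, so both are adjacent to v_c,
-- which means 2c ≡ 2 and k ≡ ±c (mod n), i.e. n = 2c - 2 and k ∈ {c, n - c}. As
-- N(n;a,b,c;k) = N(n;a,b,c;n-k) we may take k = c. For c = 4 the edge u₀v₀ has three common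
-- neighbours; for c ≥ 6 the edge u₀v₁ lies on an induced 4-cycle and u₀u₁ does not, so Γ is not
-- edge-transitive; c = 5 gives N(8;1,2,5;3). Conversely, N(8;1,2,5;3) is vertex-transitive
-- (reflections u_i ↦ u_{b-i} and the swap u_i ↔ v_{3i}) and the stabiliser of u₀ is transitive on
-- its neighbours, so it is arc-transitive; and u₀u₁ lies on exactly two triangles. These finitely
-- many facts about one 16-vertex graph are checked by evaluating decision procedures.

module Submission where

open import Defs
open import Data.Nat
open import Data.Nat.Properties
open import Data.Nat.DivMod
  using (_%_; _/_; _mod_; m%n<n; m%n%n≡m%n; m<n⇒m%n≡m; m≡m%n+[m/n]*n; [m+kn]%n≡m%n; %-distribˡ-+)
open import Data.Fin using (Fin; toℕ)
import Data.Fin.Properties as Fin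
open import Data.Vec using (Vec; lookup; []; _∷_)
open import Data.Product using (_×_; _,_; ∃-syntax; proj₁; proj₂)
import Data.Product
open import Data.Sum using (_⊎_; inj₁; inj₂)
import Data.Sum as Sum
open import Data.Empty using (⊥; ⊥-elim)
open import Relation.Nullary using (¬_; Dec; no; contradiction)
open import Relation.Nullary.Decidable using (map′; _×-dec_; _⊎-dec_; _→-dec_; from-yes; True; toWitness)
open import Relation.Binary.Definitions using (DecidableEquality)
open import Relation.Binary.PropositionalEquality
open import Function.Base using (_∘_; id)
open import Function.Bundles using (_⇔_; mk⇔; Equivalence; Inverse; mk↔ₛ′)
open import Function.Construct.Composition using (_↔-∘_)
open import Function.Construct.Symmetry using (↔-sym)
import Function.Properties.Equivalence as ⇔
open import Algebra.Properties.CommutativeSemigroup +-commutativeSemigroup using (xy∙z≈xz∙y)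

-- Graphs, automorphisms and isomorphisms

module _ {V : Set} (Adj : V → V → Set) where

  OnExactlyTwoTriangles : V → V → Set
  OnExactlyTwoTriangles x y = ∃[ z₁ ] ∃[ z₂ ] (¬ z₁ ≡ z₂ × Adj x z₁ × Adj y z₁ × Adj x z₂ × Adj y z₂
    × (∀ z → Adj x z → Adj y z → z ≡ z₁ ⊎ z ≡ z₂))

  OnInducedSquare : V → V → Set
  OnInducedSquare x y = ∃[ a ] ∃[ b ] (Adj y a × Adj a b × Adj b x
    × ¬ Adj x a × ¬ Adj y b × ¬ a ≡ x × ¬ b ≡ y)

  no-third-common-neighbour : ∀ {x y a b c} → OnExactlyTwoTriangles x y →
    Adj x a → Adj y a → Adj x b → Adj y b → Adj x c → Adj y c →
    ¬ a ≡ b → ¬ a ≡ c → ¬ b ≡ c → ⊥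
  no-third-common-neighbour (_ , _ , _ , _ , _ , _ , _ , only) xa ya xb yb xc yc a≢b a≢c b≢c
    with only _ xa ya | only _ xb yb | only _ xc yc
  ... | inj₁ refl | inj₁ refl | _         = a≢b refl
  ... | inj₂ refl | inj₂ refl | _         = a≢b refl
  ... | inj₁ refl | inj₂ refl | inj₁ refl = a≢c refl
  ... | inj₁ refl | inj₂ refl | inj₂ refl = b≢c refl
  ... | inj₂ refl | inj₁ refl | inj₁ refl = b≢c refl
  ... | inj₂ refl | inj₁ refl | inj₂ refl = a≢c refl

  onInducedSquare-sym : (∀ {x y} → Adj x y → Adj y x) → ∀ {x y} → OnInducedSquare x y → OnInducedSquare y x
  onInducedSquare-sym adj-sym (a , b , ya , ab , bx , x≁a , y≁b , a≢x , b≢y) =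
    b , a , adj-sym bx , adj-sym ab , adj-sym ya , y≁b , x≁a , b≢y , a≢x

  InvolutiveAutomorphism : (V → V) → Set
  InvolutiveAutomorphism f = (∀ x → f (f x) ≡ x) × (∀ x y → Adj x y → Adj (f x) (f y))

module _ {V W : Set} {A : V → V → Set} {B : W → W → Set} where

  isomorphic-sym : Isomorphic A B → Isomorphic B A
  isomorphic-sym ι = record
    { iso = ↔-sym (Isomorphic.iso ι)
    ; preserves = λ x y b → Isomorphic.reflects ι _ _ (subst₂ B (sym (to∘from x)) (sym (to∘from y)) b)
    ; reflects = λ x y a → subst₂ B (to∘from x) (to∘from y) (Isomorphic.preserves ι _ _ a)
    }
    where to∘from = Inverse.strictlyInverseˡ (Isomorphic.iso ι)

  module _ (ι : Isomorphic A B) where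
    private
      f : V → W
      f = Inverse.to (Isomorphic.iso ι)
      g : W → V
      g = Inverse.from (Isomorphic.iso ι)
      f∘g : ∀ y → f (g y) ≡ y
      f∘g = Inverse.strictlyInverseˡ (Isomorphic.iso ι)
      f-injective : ∀ {x y} → f x ≡ f y → x ≡ y
      f-injective {x} {y} e = trans (sym (g∘f x)) (trans (cong g e) (g∘f y))
        where g∘f = Inverse.strictlyInverseʳ (Isomorphic.iso ι)
      preserve : ∀ {x y} → A x y → B (f x) (f y)
      preserve = Isomorphic.preserves ι _ _
      reflect : ∀ {x y} → B (f x) (f y) → A x y
      reflect = Isomorphic.reflects ι _ _
      reflect-g : ∀ {x z} → B (f x) z → A x (g z)
      reflect-g {x} {z} b = reflect (subst (B (f x)) (sym (f∘g z)) b)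

    onExactlyTwoTriangles-transport : ∀ {x y} → OnExactlyTwoTriangles A x y → OnExactlyTwoTriangles B (f x) (f y)
    onExactlyTwoTriangles-transport {x} {y} (z₁ , z₂ , z₁≢z₂ , xz₁ , yz₁ , xz₂ , yz₂ , only) =
      f z₁ , f z₂ , z₁≢z₂ ∘ f-injective , preserve xz₁ , preserve yz₁ , preserve xz₂ , preserve yz₂ , only′
      where
      only′ : ∀ z → B (f x) z → B (f y) z → z ≡ f z₁ ⊎ z ≡ f z₂
      only′ z xz yz = Sum.map (λ e → trans (sym (f∘g z)) (cong f e)) (λ e → trans (sym (f∘g z)) (cong f e))
        (only (g z) (reflect-g xz) (reflect-g yz))

    onInducedSquare-transport : ∀ {x y} → OnInducedSquare A x y → OnInducedSquare B (f x) (f y)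
    onInducedSquare-transport (a , b , ya , ab , bx , x≁a , y≁b , a≢x , b≢y) =
      f a , f b , preserve ya , preserve ab , preserve bx , x≁a ∘ reflect , y≁b ∘ reflect ,
      a≢x ∘ f-injective , b≢y ∘ f-injective

module _ {U V W : Set} {A : U → U → Set} {B : V → V → Set} {C : W → W → Set} where

  isomorphic-trans : Isomorphic A B → Isomorphic B C → Isomorphic A C
  isomorphic-trans ι κ = record
    { iso = Isomorphic.iso κ ↔-∘ Isomorphic.iso ι
    ; preserves = λ x y → Isomorphic.preserves κ _ _ ∘ Isomorphic.preserves ι x y
    ; reflects = λ x y → Isomorphic.reflects ι x y ∘ Isomorphic.reflects κ _ _
    }

module _ {V : Set} {A B : V → V → Set} where

  isomorphic-of-⇔ : (∀ x y → A x y ⇔ B x y) → Isomorphic A B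
  isomorphic-of-⇔ A⇔B = record
    { iso = mk↔ₛ′ id id (λ _ → refl) (λ _ → refl)
    ; preserves = λ x y → Equivalence.to (A⇔B x y)
    ; reflects = λ x y → Equivalence.from (A⇔B x y)
    }

module _ {V : Set} {A : V → V → Set} where

  apply : Automorphism A → V → V
  apply σ = Inverse.to (perm σ)

  automorphism : Isomorphic A A → Automorphism A
  automorphism ι = record
    { perm = Isomorphic.iso ι ; preserves = Isomorphic.preserves ι ; reflects = Isomorphic.reflects ι }

  automorphism⇒isomorphic : Automorphism A → Isomorphic A A
  automorphism⇒isomorphic σ = record { iso = perm σ ; preserves = preserves σ ; reflects = reflects σ }

  identityᴬ : Automorphism A
  identityᴬ = automorphism (isomorphic-of-⇔ λ _ _ → ⇔.refl)

  infixr 9 _∘ᴬ_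
  _∘ᴬ_ : Automorphism A → Automorphism A → Automorphism A
  σ ∘ᴬ τ = automorphism (isomorphic-trans (automorphism⇒isomorphic τ) (automorphism⇒isomorphic σ))

  _⁻¹ᴬ : Automorphism A → Automorphism A
  σ ⁻¹ᴬ = automorphism (isomorphic-sym (automorphism⇒isomorphic σ))

  apply-inverseˡ : ∀ σ x → apply σ (apply (σ ⁻¹ᴬ) x) ≡ x
  apply-inverseˡ σ = Inverse.strictlyInverseˡ (perm σ)

  apply-inverseʳ : ∀ σ x → apply (σ ⁻¹ᴬ) (apply σ x) ≡ x
  apply-inverseʳ σ = Inverse.strictlyInverseʳ (perm σ)

  -- Built from the projections, not by matching on the pair, so that applying the
  -- automorphism never forces a proof obtained by evaluating a decision procedure.
  involutive-automorphism : (f : V → V) → InvolutiveAutomorphism A f → Automorphism A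
  involutive-automorphism f inv = record
    { perm = mk↔ₛ′ f f (proj₁ inv) (proj₁ inv)
    ; preserves = proj₂ inv
    ; reflects = λ x y a → subst₂ A (proj₁ inv x) (proj₁ inv y) (proj₂ inv _ _ a)
    }

  arcTransitive⇒edgeTransitive : ArcTransitive A → EdgeTransitive A
  arcTransitive⇒edgeTransitive at x y x′ y′ xy x′y′ = Data.Product.map₂ inj₁ (at x y x′ y′ xy x′y′)

  arcTransitive-from-stabiliser : ∀ x₀ y₀ →
    (∀ x → ∃[ σ ] apply σ x₀ ≡ x) →
    (∀ y → A x₀ y → ∃[ τ ] (apply τ x₀ ≡ x₀ × apply τ y₀ ≡ y)) →
    ArcTransitive A
  arcTransitive-from-stabiliser x₀ y₀ vertex-transitive stabiliser x y x′ y′ xy x′y′ =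
    through-base (from-base xy) (from-base x′y′)
    where
    from-base : ∀ {x y} → A x y → ∃[ ψ ] (apply ψ x₀ ≡ x × apply ψ y₀ ≡ y)
    from-base {x} {y} xy with vertex-transitive x
    ... | σ , refl with stabiliser (apply (σ ⁻¹ᴬ) y)
                          (reflects σ _ _ (subst (A (apply σ x₀)) (sym (apply-inverseˡ σ y)) xy))
    ...   | τ , τx₀ , τy₀ = σ ∘ᴬ τ , cong (apply σ) τx₀ , trans (cong (apply σ) τy₀) (apply-inverseˡ σ y)
    through-base : ∃[ ψ ] (apply ψ x₀ ≡ x × apply ψ y₀ ≡ y) →
                   ∃[ ψ′ ] (apply ψ′ x₀ ≡ x′ × apply ψ′ y₀ ≡ y′) →
                   ∃[ σ ] (apply σ x ≡ x′ × apply σ y ≡ y′)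
    through-base (ψ , refl , refl) (ψ′ , refl , refl) =
      ψ′ ∘ᴬ ψ ⁻¹ᴬ , cong (apply ψ′) (apply-inverseʳ ψ x₀) , cong (apply ψ′) (apply-inverseʳ ψ y₀)

  everyEdgeOnExactlyTwoTriangles-from-arcTransitive : ArcTransitive A → ∀ {x₀ y₀} → A x₀ y₀ →
    OnExactlyTwoTriangles A x₀ y₀ → EveryEdgeOnExactlyTwoTriangles A
  everyEdgeOnExactlyTwoTriangles-from-arcTransitive at x₀y₀ two x y xy with at _ _ x y x₀y₀ xy
  ... | σ , refl , refl = onExactlyTwoTriangles-transport (automorphism⇒isomorphic σ) two

  onInducedSquare-edgeTransitive : (∀ {x y} → A x y → A y x) → EdgeTransitive A →
    ∀ {x y x′ y′} → A x y → A x′ y′ → OnInducedSquare A x y → OnInducedSquare A x′ y′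
  onInducedSquare-edgeTransitive adj-sym et {x} {y} {x′} {y′} xy x′y′ square with et x y x′ y′ xy x′y′
  ... | σ , inj₁ (refl , refl) = onInducedSquare-transport (automorphism⇒isomorphic σ) square
  ... | σ , inj₂ (refl , refl) =
    onInducedSquare-sym A adj-sym (onInducedSquare-transport (automorphism⇒isomorphic σ) square)

module _ {V W : Set} {A : V → V → Set} {B : W → W → Set} (ι : Isomorphic A B) where
  private
    f : V → W
    f = Inverse.to (Isomorphic.iso ι)
    g : W → V
    g = Inverse.from (Isomorphic.iso ι)
    g∘f : ∀ x → g (f x) ≡ x
    g∘f = Inverse.strictlyInverseʳ (Isomorphic.iso ι)

  edgeTransitive-pullback : EdgeTransitive B → EdgeTransitive A
  edgeTransitive-pullback et x y x′ y′ xy x′y′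
    with et (f x) (f y) (f x′) (f y′) (Isomorphic.preserves ι _ _ xy) (Isomorphic.preserves ι _ _ x′y′)
  ... | σ , σ-maps = conjugate , Sum.map (back x′ y′) (back y′ x′) σ-maps
    where
    conjugate : Automorphism A
    conjugate =
      automorphism (isomorphic-trans ι (isomorphic-trans (automorphism⇒isomorphic σ) (isomorphic-sym ι)))
    back : ∀ p q → apply σ (f x) ≡ f p × apply σ (f y) ≡ f q → apply conjugate x ≡ p × apply conjugate y ≡ q
    back p q (e₁ , e₂) = trans (cong g e₁) (g∘f p) , trans (cong g e₂) (g∘f q)

  everyEdgeOnExactlyTwoTriangles-pullback : EveryEdgeOnExactlyTwoTriangles B → EveryEdgeOnExactlyTwoTriangles A
  everyEdgeOnExactlyTwoTriangles-pullback two x y xy =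
    subst₂ (OnExactlyTwoTriangles A) (g∘f x) (g∘f y)
      (onExactlyTwoTriangles-transport (isomorphic-sym ι) (two _ _ (Isomorphic.preserves ι _ _ xy)))

-- Congruence modulo n

module Modular (n : ℕ) .{{_ : NonZero n}} where

  -- A record rather than a synonym for x % n ≡ y % n, so that x and y can be inferred.
  infix 4 _≈_
  record _≈_ (x y : ℕ) : Set where
    constructor mod≡
    field mod-≡ : x % n ≡ y % n

  ≈-refl : ∀ {x} → x ≈ x
  ≈-refl = mod≡ refl

  ≈-reflexive : ∀ {x y} → x ≡ y → x ≈ y
  ≈-reflexive refl = ≈-refl

  ≈-sym : ∀ {x y} → x ≈ y → y ≈ x
  ≈-sym (mod≡ e) = mod≡ (sym e)

  ≈-trans : ∀ {x y z} → x ≈ y → y ≈ z → x ≈ z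
  ≈-trans (mod≡ e) (mod≡ f) = mod≡ (trans e f)

  modEq⇒≈ : ∀ {x y} → ModEq n x y → x ≈ y
  modEq⇒≈ {y = y} (q , inj₁ refl) = mod≡ ([m+kn]%n≡m%n y q n)
  modEq⇒≈ {x = x} (q , inj₂ refl) = mod≡ (sym ([m+kn]%n≡m%n x q n))

  private
    ≡+quotient-difference : ∀ {x y} → x % n ≡ y % n → x / n ≤ y / n → y ≡ x + (y / n ∸ x / n) * n
    ≡+quotient-difference {x} {y} e x/n≤y/n = begin
      y                                         ≡⟨ m≡m%n+[m/n]*n y n ⟩
      y % n + y / n * n                         ≡⟨ cong₂ (λ r q → r + q * n) (sym e) (sym (m+[n∸m]≡n x/n≤y/n)) ⟩
      x % n + (x / n + (y / n ∸ x / n)) * n     ≡⟨ cong (x % n +_) (*-distribʳ-+ n (x / n) (y / n ∸ x / n)) ⟩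
      x % n + (x / n * n + (y / n ∸ x / n) * n) ≡⟨ +-assoc (x % n) (x / n * n) _ ⟨
      x % n + x / n * n + (y / n ∸ x / n) * n   ≡⟨ cong (_+ (y / n ∸ x / n) * n) (m≡m%n+[m/n]*n x n) ⟨
      x + (y / n ∸ x / n) * n                   ∎
      where open ≡-Reasoning

  ≈⇒modEq : ∀ {x y} → x ≈ y → ModEq n x y
  ≈⇒modEq {x} {y} (mod≡ e) with ≤-total (x / n) (y / n)
  ... | inj₁ ≤ = y / n ∸ x / n , inj₂ (≡+quotient-difference e ≤)
  ... | inj₂ ≥ = x / n ∸ y / n , inj₁ (≡+quotient-difference (sym e) ≥)

  +-congʳ : ∀ {x y} z → x ≈ y → x + z ≈ y + z
  +-congʳ {x} {y} z (mod≡ e) = mod≡ (begin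
    (x + z) % n             ≡⟨ %-distribˡ-+ x z n ⟩
    (x % n + z % n) % n     ≡⟨ cong (λ r → (r + z % n) % n) e ⟩
    (y % n + z % n) % n     ≡⟨ %-distribˡ-+ y z n ⟨
    (y + z) % n             ∎)
    where open ≡-Reasoning

  +-congˡ : ∀ {x y} z → x ≈ y → z + x ≈ z + y
  +-congˡ {x} {y} z e rewrite +-comm z x | +-comm z y = +-congʳ z e

  +-cancelʳ : ∀ {x y} z → x + z ≈ y + z → x ≈ y
  +-cancelʳ {x} {y} z e with ≈⇒modEq e
  ... | q , inj₁ p = modEq⇒≈ (q , inj₁ (+-cancelʳ-≡ z x _ (trans p (xy∙z≈xz∙y y z (q * n)))))
  ... | q , inj₂ p = modEq⇒≈ (q , inj₂ (+-cancelʳ-≡ z y _ (trans p (xy∙z≈xz∙y x z (q * n)))))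

  +-cancelˡ : ∀ {x y} z → z + x ≈ z + y → x ≈ y
  +-cancelˡ {x} {y} z e rewrite +-comm z x | +-comm z y = +-cancelʳ z e

  n≈0 : n ≈ 0
  n≈0 = modEq⇒≈ (1 , inj₁ (sym (+-identityʳ n)))

  +-complement : ∀ {k k′ x y} → k + k′ ≡ n → x + k ≈ y → y + k′ ≈ x
  +-complement {k} {k′} {x} {y} k+k′≡n x+k≈y =
    ≈-trans (+-congʳ k′ (≈-sym x+k≈y))
      (≈-trans (≈-reflexive (trans (+-assoc x k k′) (cong (x +_) k+k′≡n)))
        (≈-trans (+-congˡ x n≈0) (≈-reflexive (+-identityʳ x))))

  ≈⇒≡ : ∀ {x y} → x < n → y < n → x ≈ y → x ≡ y
  ≈⇒≡ x<n y<n (mod≡ e) = trans (sym (m<n⇒m%n≡m x<n)) (trans e (m<n⇒m%n≡m y<n))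

  ≢⇒≉ : ∀ {x y} → x < n → y < n → x ≢ y → ¬ x ≈ y
  ≢⇒≉ x<n y<n x≢y = x≢y ∘ ≈⇒≡ x<n y<n

  ≈⇒≡∨≡+n : ∀ {x y} → x ≈ y → y < n → x < n + n → x ≡ y ⊎ x ≡ y + n
  ≈⇒≡∨≡+n {x} {y} e y<n x<2n with ≈⇒modEq e
  ... | zero , inj₁ x≡y = inj₁ (trans x≡y (+-identityʳ y))
  ... | zero , inj₂ y≡x = inj₁ (sym (trans y≡x (+-identityʳ x)))
  ... | suc zero , inj₁ x≡y = inj₂ (trans x≡y (cong (y +_) (+-identityʳ n)))
  ... | suc (suc q) , inj₁ refl =
    contradiction x<2n (≤⇒≯ (≤-trans (+-monoʳ-≤ n (m≤m+n n (q * n))) (m≤n+m (n + (n + q * n)) y)))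
  ... | suc q , inj₂ refl = contradiction y<n (≤⇒≯ (≤-trans (m≤m+n n (q * n)) (m≤n+m (n + q * n) x)))

  last : ℕ
  last = n ∸ 1

  last+1≈0 : last + 1 ≈ 0
  last+1≈0 = ≈-trans (≈-reflexive (m∸n+n≡m (>-nonZero⁻¹ n))) n≈0

  last+2≈1 : last + 2 ≈ 1
  last+2≈1 = ≈-trans (≈-reflexive (sym (+-assoc last 1 1))) (+-congʳ 1 last+1≈0)

-- Nest graphs

module Nest (n : ℕ) .{{_ : NonZero n}} (a b c k : ℕ) where
  open Modular n public

  Adj : Vtx n → Vtx n → Set
  Adj = NestAdj n a b c k

  U V : ℕ → Vtx n
  U x = u (x mod n)
  V x = v (x mod n)

  toℕ-mod : ∀ x → toℕ (x mod n) ≈ x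
  toℕ-mod x = mod≡ (trans (cong (_% n) (Fin.toℕ-fromℕ< (m%n<n x n))) (m%n%n≡m%n x n))

  mod-toℕ : ∀ (i : Fin n) → toℕ i mod n ≡ i
  mod-toℕ i = Fin.toℕ-injective (trans (Fin.toℕ-fromℕ< (m%n<n (toℕ i) n)) (m<n⇒m%n≡m (Fin.toℕ<n i)))

  mod-cong : ∀ {x y} → x ≈ y → x mod n ≡ y mod n
  mod-cong {x} {y} e = Fin.toℕ-injective (≈⇒≡ (Fin.toℕ<n (x mod n)) (Fin.toℕ<n (y mod n))
    (≈-trans (toℕ-mod x) (≈-trans e (≈-sym (toℕ-mod y)))))

  mod-injective : ∀ {x y} → x mod n ≡ y mod n → x ≈ y
  mod-injective {x} {y} e = ≈-trans (≈-sym (toℕ-mod x)) (≈-trans (≈-reflexive (cong toℕ e)) (toℕ-mod y))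

  modEq-mod : ∀ {x y} d → ModEq n (toℕ (x mod n) + d) (toℕ (y mod n)) ⇔ (x + d ≈ y)
  modEq-mod {x} {y} d = mk⇔
    (λ e → ≈-trans (≈-sym (+-congʳ d (toℕ-mod x))) (≈-trans (modEq⇒≈ e) (toℕ-mod y)))
    (λ e → ≈⇒modEq (≈-trans (+-congʳ d (toℕ-mod x)) (≈-trans e (≈-sym (toℕ-mod y)))))

  modEq-mod₀ : ∀ {x y} → ModEq n (toℕ (x mod n)) (toℕ (y mod n)) ⇔ (x ≈ y)
  modEq-mod₀ {x} {y} = mk⇔
    (λ e → ≈-trans (≈-sym (toℕ-mod x)) (≈-trans (modEq⇒≈ e) (toℕ-mod y)))
    (λ e → ≈⇒modEq (≈-trans (toℕ-mod x) (≈-trans e (≈-sym (toℕ-mod y)))))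

  Vtx-elim : (P : Vtx n → Set) → (∀ x → P (U x)) → (∀ x → P (V x)) → ∀ w → P w
  Vtx-elim P PU PV (u i) = subst (P ∘ u) (mod-toℕ i) (PU (toℕ i))
  Vtx-elim P PU PV (v i) = subst (P ∘ v) (mod-toℕ i) (PV (toℕ i))

  U-cong : ∀ {x y} → x ≈ y → U x ≡ U y
  U-cong = cong u ∘ mod-cong

  V-cong : ∀ {x y} → x ≈ y → V x ≡ V y
  V-cong = cong v ∘ mod-cong

  index : Vtx n → Fin n
  index (u i) = i
  index (v i) = i

  U-injective : ∀ {x y} → U x ≡ U y → x ≈ y
  U-injective = mod-injective ∘ cong index

  V-injective : ∀ {x y} → V x ≡ V y → x ≈ y
  V-injective = mod-injective ∘ cong index

  adj-sym : ∀ {x y} → Adj x y → Adj y x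
  adj-sym = Sum.swap

  Offset : ℕ → ℕ → Set
  Offset x y = x ≈ y ⊎ x + a ≈ y ⊎ x + b ≈ y ⊎ x + c ≈ y

  adjUU : ∀ {x y} → x + 1 ≈ y ⊎ y + 1 ≈ x → Adj (U x) (U y)
  adjUU = Sum.map (Equivalence.from (modEq-mod 1)) (Equivalence.from (modEq-mod 1))

  adjUU⁻¹ : ∀ {x y} → Adj (U x) (U y) → x + 1 ≈ y ⊎ y + 1 ≈ x
  adjUU⁻¹ = Sum.map (Equivalence.to (modEq-mod 1)) (Equivalence.to (modEq-mod 1))

  adjVV : ∀ {x y} → x + k ≈ y ⊎ y + k ≈ x → Adj (V x) (V y)
  adjVV = Sum.map (Equivalence.from (modEq-mod k)) (Equivalence.from (modEq-mod k))

  adjVV⁻¹ : ∀ {x y} → Adj (V x) (V y) → x + k ≈ y ⊎ y + k ≈ x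
  adjVV⁻¹ = Sum.map (Equivalence.to (modEq-mod k)) (Equivalence.to (modEq-mod k))

  adjUV : ∀ {x y} → Offset x y → Adj (U x) (V y)
  adjUV = inj₁ ∘ Sum.map (Equivalence.from modEq-mod₀)
    (Sum.map (Equivalence.from (modEq-mod a)) (Sum.map (Equivalence.from (modEq-mod b)) (Equivalence.from (modEq-mod c))))

  adjUV⁻¹ : ∀ {x y} → Adj (U x) (V y) → Offset x y
  adjUV⁻¹ (inj₁ e) = Sum.map (Equivalence.to modEq-mod₀)
    (Sum.map (Equivalence.to (modEq-mod a)) (Sum.map (Equivalence.to (modEq-mod b)) (Equivalence.to (modEq-mod c)))) e

  adjUV₀ : ∀ {x y} → x ≈ y → Adj (U x) (V y)
  adjUV₀ = adjUV ∘ inj₁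

  adjUVᵃ : ∀ {x y} → x + a ≈ y → Adj (U x) (V y)
  adjUVᵃ = adjUV ∘ inj₂ ∘ inj₁

  adjUVᵇ : ∀ {x y} → x + b ≈ y → Adj (U x) (V y)
  adjUVᵇ = adjUV ∘ inj₂ ∘ inj₂ ∘ inj₁

  adjUVᶜ : ∀ {x y} → x + c ≈ y → Adj (U x) (V y)
  adjUVᶜ = adjUV ∘ inj₂ ∘ inj₂ ∘ inj₂

  adjacent? : ∀ x y → Dec (Adj x y)
  adjacent? x y = edge? x y ⊎-dec edge? y x
    where
    modEq? : ∀ p q → Dec (ModEq n p q)
    modEq? p q = map′ (≈⇒modEq ∘ mod≡) (_≈_.mod-≡ ∘ modEq⇒≈) (p % n ≟ q % n)
    edge? : ∀ x y → Dec (NestE n a b c k x y)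
    edge? (u i) (u j) = modEq? _ _
    edge? (u i) (v j) = modEq? _ _ ⊎-dec modEq? _ _ ⊎-dec modEq? _ _ ⊎-dec modEq? _ _
    edge? (v i) (u j) = no λ ()
    edge? (v i) (v j) = modEq? _ _

  edge : ∀ x y → {True (adjacent? x y)} → Adj x y
  edge x y {p} = toWitness p

nestAdj-complement : ∀ {n} .{{_ : NonZero n}} {a b c k k′} → k + k′ ≡ n →
  ∀ x y → NestAdj n a b c k x y ⇔ NestAdj n a b c k′ x y
nestAdj-complement {n} {k = k} {k′} k+k′≡n (v i) (v j) =
  mk⇔ (reverse k+k′≡n) (reverse (trans (+-comm k′ k) k+k′≡n))
  where
  open Modular n
  turn : ∀ {k k′ x y} → k + k′ ≡ n → ModEq n (x + k) y → ModEq n (y + k′) x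
  turn k+k′≡n = ≈⇒modEq ∘ +-complement k+k′≡n ∘ modEq⇒≈
  reverse : ∀ {k k′ x y} → k + k′ ≡ n →
    ModEq n (x + k) y ⊎ ModEq n (y + k) x → ModEq n (x + k′) y ⊎ ModEq n (y + k′) x
  reverse k+k′≡n = Sum.swap ∘ Sum.map (turn k+k′≡n) (turn k+k′≡n)
nestAdj-complement _ (u i) (u j) = ⇔.refl
nestAdj-complement _ (u i) (v j) = ⇔.refl
nestAdj-complement _ (v i) (u j) = ⇔.refl

-- N(n;1,2,c;k) with every edge on exactly two triangles

module TwoTriangles (n : ℕ) .{{_ : NonZero n}} (c k : ℕ) (4≤n : 4 ≤ n) (3≤c : 3 ≤ c) (c<n : c < n)
                    (0<k : 0 < k) (k<n : k < n)
                    (two : EveryEdgeOnExactlyTwoTriangles (NestAdj n 1 2 c k)) where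
  open Nest n 1 2 c k

  private
    3<n : 3 < n
    3<n = 4≤n
    2<n : 2 < n
    2<n = <-trans (n<1+n 2) 3<n
    1<n : 1 < n
    1<n = <-trans (n<1+n 1) 2<n
    0<n : 0 < n
    0<n = <-trans (n<1+n 0) 1<n

    small≢c : ∀ {p} → p < 3 → p ≢ c
    small≢c p<3 p≡c = <⇒≱ p<3 (subst (3 ≤_) (sym p≡c) 3≤c)

    V-distinct : ∀ {p q} → p < n → q < n → p ≢ q → V p ≢ V q
    V-distinct p<n q<n p≢q = ≢⇒≉ p<n q<n p≢q ∘ V-injective

    u₀u₁ : Adj (U 0) (U 1)
    u₀u₁ = adjUU (inj₁ ≈-refl)

  -- Otherwise v₁, v₂ and v₃ are common neighbours of u₀ and u₁.
  c≢3 : c ≢ 3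
  c≢3 refl = no-third-common-neighbour Adj (two _ _ u₀u₁)
    (adjUVᵃ ≈-refl) (adjUV₀ ≈-refl) (adjUVᵇ ≈-refl) (adjUVᵃ ≈-refl) (adjUVᶜ ≈-refl) (adjUVᵇ ≈-refl)
    (V-distinct 1<n 2<n λ ()) (V-distinct 1<n 3<n λ ()) (V-distinct 2<n 3<n λ ())

  4≤c : 4 ≤ c
  4≤c with m≤n⇒m<n∨m≡n 3≤c
  ... | inj₁ 3<c = 3<c
  ... | inj₂ 3≡c = contradiction (sym 3≡c) c≢3

  private
    -- Otherwise v₀, v₁ and v₂ are common neighbours of u₀ and u₁.
    1+c≢n : 1 + c ≢ n
    1+c≢n 1+c≡n = no-third-common-neighbour Adj (two _ _ u₀u₁)
      (adjUV₀ ≈-refl) (adjUVᶜ (≈-trans (≈-reflexive 1+c≡n) n≈0))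
      (adjUVᵃ ≈-refl) (adjUV₀ ≈-refl) (adjUVᵇ ≈-refl) (adjUVᵃ ≈-refl)
      (V-distinct 0<n 1<n λ ()) (V-distinct 0<n 2<n λ ()) (V-distinct 1<n 2<n λ ())

    1+c≉0 : ¬ 1 + c ≈ 0
    1+c≉0 with m≤n⇒m<n∨m≡n c<n
    ... | inj₁ 1+c<n = ≢⇒≉ 1+c<n 0<n (λ ())
    ... | inj₂ 1+c≡n = λ _ → 1+c≢n 1+c≡n

    -- Otherwise u₁, u_{n-1} and v_c are common neighbours of u₀ and v₁.
    v₁≁v_c : ¬ Adj (V 1) (V c)
    v₁≁v_c v₁v_c = no-third-common-neighbour Adj (two _ _ (adjUVᵃ ≈-refl))
      u₀u₁ (adj-sym (adjUV₀ ≈-refl))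
      (adjUU (inj₂ last+1≈0)) (adj-sym (adjUVᵇ last+2≈1))
      (adjUVᶜ ≈-refl) v₁v_c
      (λ e → ≢⇒≉ 2<n 0<n (λ ()) (≈-trans (+-congʳ 1 (U-injective e)) last+1≈0))
      (λ ()) (λ ())

    common-u₀-v_c : ∀ w → Adj (U 0) w → Adj (V c) w → w ≡ V 0 ⊎ w ≡ V 2
    common-u₀-v_c = Vtx-elim _ viaU viaV
      where
      viaU : ∀ x → Adj (U 0) (U x) → Adj (V c) (U x) → U x ≡ V 0 ⊎ U x ≡ V 2
      viaU x u₀uₓ v_cuₓ with adjUU⁻¹ u₀uₓ | adjUV⁻¹ (adj-sym v_cuₓ)
      ... | inj₁ e | inj₁ r = contradiction (≈⇒≡ 1<n c<n (≈-trans e r)) (small≢c (s≤s (s≤s z≤n)))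
      ... | inj₁ e | inj₂ (inj₁ r) = contradiction (≈⇒≡ 2<n c<n (≈-trans (+-congʳ 1 e) r)) (small≢c ≤-refl)
      ... | inj₁ e | inj₂ (inj₂ (inj₁ r)) = contradiction (≈⇒≡ c<n 3<n (≈-sym (≈-trans (+-congʳ 2 e) r))) c≢3
      ... | inj₁ e | inj₂ (inj₂ (inj₂ r)) = ⊥-elim (≢⇒≉ 1<n 0<n (λ ()) (≈-trans e (+-cancelʳ c r)))
      ... | inj₂ e | inj₁ r =
            ⊥-elim (1+c≉0 (≈-trans (≈-reflexive (+-comm 1 c)) (≈-trans (+-congʳ 1 (≈-sym r)) e)))
      ... | inj₂ e | inj₂ (inj₁ r) = contradiction (≈⇒≡ 0<n c<n (≈-trans (≈-sym e) r)) (small≢c (s≤s z≤n))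
      ... | inj₂ e | inj₂ (inj₂ (inj₁ r)) = contradiction
            (≈⇒≡ 1<n c<n (≈-trans (≈-sym (+-congʳ 1 e)) (≈-trans (≈-reflexive (+-assoc x 1 1)) r)))
            (small≢c (s≤s (s≤s z≤n)))
      ... | inj₂ e | inj₂ (inj₂ (inj₂ r)) =
            ⊥-elim (≢⇒≉ 0<n 1<n (λ ()) (≈-trans (≈-sym e) (+-congʳ 1 (+-cancelʳ c r))))
      viaV : ∀ x → Adj (U 0) (V x) → Adj (V c) (V x) → V x ≡ V 0 ⊎ V x ≡ V 2
      viaV x u₀vₓ v_cvₓ with adjUV⁻¹ u₀vₓ
      ... | inj₁ e = inj₁ (V-cong (≈-sym e))
      ... | inj₂ (inj₁ e) = contradiction (adj-sym {V c} {V 1} (subst (Adj (V c)) (V-cong (≈-sym e)) v_cvₓ)) v₁≁v_c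
      ... | inj₂ (inj₂ (inj₁ e)) = inj₂ (V-cong (≈-sym e))
      ... | inj₂ (inj₂ (inj₂ e)) with adjVV⁻¹ v_cvₓ
      ...   | inj₁ r = ⊥-elim (≢⇒≉ k<n 0<n (>⇒≢ 0<k)
                        (+-cancelˡ c (≈-trans r (≈-trans (≈-sym e) (≈-reflexive (sym (+-identityʳ c)))))))
      ...   | inj₂ r = ⊥-elim (≢⇒≉ k<n 0<n (>⇒≢ 0<k)
                        (+-cancelˡ x (≈-trans r (≈-trans e (≈-reflexive (sym (+-identityʳ x)))))))

    v_c-adjacent : Adj (V c) (V 0) × Adj (V c) (V 2)
    v_c-adjacent with two (U 0) (V c) (adjUVᶜ ≈-refl)
    ... | z₁ , z₂ , z₁≢z₂ , u₀z₁ , v_cz₁ , u₀z₂ , v_cz₂ , _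
      with common-u₀-v_c z₁ u₀z₁ v_cz₁ | common-u₀-v_c z₂ u₀z₂ v_cz₂
    ... | inj₁ refl | inj₁ refl = contradiction refl z₁≢z₂
    ... | inj₁ refl | inj₂ refl = v_cz₁ , v_cz₂
    ... | inj₂ refl | inj₁ refl = v_cz₂ , v_cz₁
    ... | inj₂ refl | inj₂ refl = contradiction refl z₁≢z₂

    congruences : c + c ≈ 2 × (k ≈ c ⊎ c + k ≈ 0)
    congruences with adjVV⁻¹ (proj₁ v_c-adjacent) | adjVV⁻¹ (proj₂ v_c-adjacent)
    ... | inj₂ k≈c | inj₁ c+k≈2 = ≈-trans (+-congˡ c (≈-sym k≈c)) c+k≈2 , inj₁ k≈c
    ... | inj₁ c+k≈0 | inj₂ 2+k≈c =
      ≈-trans (+-congˡ c (≈-sym 2+k≈c))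
        (≈-trans (≈-reflexive (trans (+-comm c (2 + k)) (cong (2 +_) (+-comm k c)))) (+-congˡ 2 c+k≈0)) ,
      inj₂ c+k≈0
    ... | inj₁ c+k≈0 | inj₁ c+k≈2 = ⊥-elim (≢⇒≉ 0<n 2<n (λ ()) (≈-trans (≈-sym c+k≈0) c+k≈2))
    ... | inj₂ k≈c | inj₂ 2+k≈c = ⊥-elim (≢⇒≉ 2<n 0<n (λ ()) (+-cancelʳ k (≈-trans 2+k≈c (≈-sym k≈c))))

  c+c≡2+n : c + c ≡ 2 + n
  c+c≡2+n with ≈⇒≡∨≡+n (proj₁ congruences) 2<n (+-mono-< c<n c<n)
  ... | inj₂ c+c≡2+n = c+c≡2+n
  ... | inj₁ c+c≡2 = contradiction (subst (6 ≤_) c+c≡2 (+-mono-≤ 3≤c 3≤c)) λ { (s≤s (s≤s ())) }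

  k≡c⊎c+k≡n : k ≡ c ⊎ c + k ≡ n
  k≡c⊎c+k≡n with proj₂ congruences
  ... | inj₁ k≈c = inj₁ (≈⇒≡ k<n c<n k≈c)
  ... | inj₂ c+k≈0 with ≈⇒≡∨≡+n c+k≈0 0<n (+-mono-< c<n k<n)
  ...   | inj₂ c+k≡n = inj₂ c+k≡n
  ...   | inj₁ c+k≡0 = contradiction (subst (3 ≤_) c+k≡0 (≤-trans 3≤c (m≤m+n c k))) λ ()

-- Two edge orbits of N(n;1,2,c;c) for c ≥ 6

module InducedSquares (n : ℕ) .{{_ : NonZero n}} (c : ℕ) (6≤c : 6 ≤ c) (c+c≡2+n : c + c ≡ 2 + n) where
  open Nest n 1 2 c c

  private
    4+c≤n : 4 + c ≤ n
    4+c≤n = ≤-pred (≤-pred (subst (6 + c ≤_) c+c≡2+n (≤-trans (≤-reflexive (+-comm 6 c)) (+-monoʳ-≤ c 6≤c))))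

    c<n : c < n
    c<n = ≤-trans (m≤n+m (suc c) 3) 4+c≤n
    1+c<n : 1 + c < n
    1+c<n = ≤-trans (m≤n+m (2 + c) 2) 4+c≤n
    2+c<n : 2 + c < n
    2+c<n = ≤-trans (m≤n+m (3 + c) 1) 4+c≤n
    3+c<n : 3 + c < n
    3+c<n = 4+c≤n
    4<n : 4 < n
    4<n = ≤-trans (+-monoʳ-≤ 4 (≤-trans (s≤s z≤n) 6≤c)) 4+c≤n
    3<n : 3 < n
    3<n = <-trans (n<1+n 3) 4<n
    2<n : 2 < n
    2<n = <-trans (n<1+n 2) 3<n
    1<n : 1 < n
    1<n = <-trans (n<1+n 1) 2<n
    0<n : 0 < n
    0<n = <-trans (n<1+n 0) 1<n

    c≢small : ∀ {p} → p < 6 → c ≢ p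
    c≢small p<6 refl = <⇒≱ p<6 6≤c

    m : ℕ
    m = pred c
    1+m≡c : 1 + m ≡ c
    1+m≡c = suc-pred c {{>-nonZero (≤-trans (s≤s z≤n) 6≤c)}}
    m<n : m < n
    m<n = <-trans (subst (m <_) 1+m≡c (n<1+n m)) c<n

    c+c≈2 : c + c ≈ 2
    c+c≈2 = ≈-trans (≈-reflexive c+c≡2+n) (+-congˡ 2 n≈0)

  u₀v₁-onInducedSquare : OnInducedSquare Adj (U 0) (V 1)
  u₀v₁-onInducedSquare =
    U m , V c , adj-sym (adjUVᶜ m+c≈1) , adjUVᵃ (≈-reflexive (trans (+-comm m 1) 1+m≡c)) ,
    adj-sym (adjUVᶜ ≈-refl) , u₀≁uₘ , v₁≁v_c ,
    (λ e → c≢small (s≤s (s≤s z≤n)) (trans (sym 1+m≡c) (cong suc (≈⇒≡ m<n 0<n (U-injective e))))) ,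
    (λ e → c≢small (s≤s (s≤s z≤n)) (≈⇒≡ c<n 1<n (V-injective e)))
    where
    m+c≈1 : m + c ≈ 1
    m+c≈1 = +-cancelˡ 1 (≈-trans (≈-reflexive (cong (_+ c) 1+m≡c)) c+c≈2)
    u₀≁uₘ : ¬ Adj (U 0) (U m)
    u₀≁uₘ u₀uₘ with adjUU⁻¹ u₀uₘ
    ... | inj₁ 1≈m = c≢small (s≤s (s≤s (s≤s z≤n))) (trans (sym 1+m≡c) (cong suc (sym (≈⇒≡ 1<n m<n 1≈m))))
    ... | inj₂ m+1≈0 =
      c≢small (s≤s z≤n) (≈⇒≡ c<n 0<n (≈-trans (≈-reflexive (trans (sym 1+m≡c) (+-comm 1 m))) m+1≈0))
    v₁≁v_c : ¬ Adj (V 1) (V c)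
    v₁≁v_c v₁v_c with adjVV⁻¹ v₁v_c
    ... | inj₁ 1+c≈c = ≢⇒≉ 1<n 0<n (λ ()) (+-cancelʳ c 1+c≈c)
    ... | inj₂ c+c≈1 = ≢⇒≉ 2<n 1<n (λ ()) (≈-trans (≈-sym c+c≈2) c+c≈1)

  private
    opposite-u₁ : ∀ a → Adj (U 1) a → ¬ Adj (U 0) a → a ≢ U 0 → a ≡ U 2 ⊎ a ≡ V 3 ⊎ a ≡ V (1 + c)
    opposite-u₁ = Vtx-elim _ viaU viaV
      where
      viaU : ∀ x → Adj (U 1) (U x) → ¬ Adj (U 0) (U x) → U x ≢ U 0 →
             U x ≡ U 2 ⊎ U x ≡ V 3 ⊎ U x ≡ V (1 + c)
      viaU x u₁uₓ _ uₓ≢u₀ with adjUU⁻¹ u₁uₓ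
      ... | inj₁ 2≈x = inj₁ (U-cong (≈-sym 2≈x))
      ... | inj₂ x+1≈1 = contradiction (U-cong (+-cancelʳ 1 x+1≈1)) uₓ≢u₀
      viaV : ∀ x → Adj (U 1) (V x) → ¬ Adj (U 0) (V x) → V x ≢ U 0 →
             V x ≡ U 2 ⊎ V x ≡ V 3 ⊎ V x ≡ V (1 + c)
      viaV x u₁vₓ u₀≁vₓ _ with adjUV⁻¹ u₁vₓ
      ... | inj₁ 1≈x = contradiction (adjUVᵃ 1≈x) u₀≁vₓ
      ... | inj₂ (inj₁ 2≈x) = contradiction (adjUVᵇ 2≈x) u₀≁vₓ
      ... | inj₂ (inj₂ (inj₁ 3≈x)) = inj₂ (inj₁ (V-cong (≈-sym 3≈x)))
      ... | inj₂ (inj₂ (inj₂ 1+c≈x)) = inj₂ (inj₂ (V-cong (≈-sym 1+c≈x)))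

    opposite-u₀ : ∀ b → Adj b (U 0) → ¬ Adj (U 1) b → b ≢ U 1 → b ≡ U last ⊎ b ≡ V 0 ⊎ b ≡ V c
    opposite-u₀ = Vtx-elim _ viaU viaV
      where
      viaU : ∀ x → Adj (U x) (U 0) → ¬ Adj (U 1) (U x) → U x ≢ U 1 →
             U x ≡ U last ⊎ U x ≡ V 0 ⊎ U x ≡ V c
      viaU x uₓu₀ _ uₓ≢u₁ with adjUU⁻¹ uₓu₀
      ... | inj₁ x+1≈0 = inj₁ (U-cong (+-cancelʳ 1 (≈-trans x+1≈0 (≈-sym last+1≈0))))
      ... | inj₂ 1≈x = contradiction (U-cong (≈-sym 1≈x)) uₓ≢u₁
      viaV : ∀ x → Adj (V x) (U 0) → ¬ Adj (U 1) (V x) → V x ≢ U 1 →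
             V x ≡ U last ⊎ V x ≡ V 0 ⊎ V x ≡ V c
      viaV x vₓu₀ u₁≁vₓ _ with adjUV⁻¹ (adj-sym {V x} {U 0} vₓu₀)
      ... | inj₁ 0≈x = inj₂ (inj₁ (V-cong (≈-sym 0≈x)))
      ... | inj₂ (inj₁ 1≈x) = contradiction (adjUV₀ 1≈x) u₁≁vₓ
      ... | inj₂ (inj₂ (inj₁ 2≈x)) = contradiction (adjUVᵃ 2≈x) u₁≁vₓ
      ... | inj₂ (inj₂ (inj₂ c≈x)) = inj₂ (inj₂ (V-cong (≈-sym c≈x)))

    u₂≁u_last : ¬ Adj (U 2) (U last)
    u₂≁u_last a with adjUU⁻¹ a
    ... | inj₁ 3≈last = ≢⇒≉ 4<n 0<n (λ ()) (≈-trans (+-congʳ 1 3≈last) last+1≈0)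
    ... | inj₂ last+1≈2 = ≢⇒≉ 0<n 2<n (λ ()) (≈-trans (≈-sym last+1≈0) last+1≈2)

    u₂≁v₀ : ¬ Adj (U 2) (V 0)
    u₂≁v₀ a with adjUV⁻¹ a
    ... | inj₁ e = ≢⇒≉ 2<n 0<n (λ ()) e
    ... | inj₂ (inj₁ e) = ≢⇒≉ 3<n 0<n (λ ()) e
    ... | inj₂ (inj₂ (inj₁ e)) = ≢⇒≉ 4<n 0<n (λ ()) e
    ... | inj₂ (inj₂ (inj₂ e)) = ≢⇒≉ 2+c<n 0<n (λ ()) e

    u₂≁v_c : ¬ Adj (U 2) (V c)
    u₂≁v_c a with adjUV⁻¹ a
    ... | inj₁ e = c≢small (s≤s (s≤s (s≤s z≤n))) (≈⇒≡ c<n 2<n (≈-sym e))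
    ... | inj₂ (inj₁ e) = c≢small (s≤s (s≤s (s≤s (s≤s z≤n)))) (≈⇒≡ c<n 3<n (≈-sym e))
    ... | inj₂ (inj₂ (inj₁ e)) = c≢small (s≤s (s≤s (s≤s (s≤s (s≤s z≤n))))) (≈⇒≡ c<n 4<n (≈-sym e))
    ... | inj₂ (inj₂ (inj₂ e)) = ≢⇒≉ 2<n 0<n (λ ()) (+-cancelʳ c e)

    v₃≁u_last : ¬ Adj (V 3) (U last)
    v₃≁u_last a with adjUV⁻¹ (adj-sym {V 3} {U last} a)
    ... | inj₁ e = ≢⇒≉ 0<n 4<n (λ ()) (≈-trans (≈-sym last+1≈0) (+-congʳ 1 e))
    ... | inj₂ (inj₁ e) = ≢⇒≉ 0<n 3<n (λ ()) (≈-trans (≈-sym last+1≈0) e)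
    ... | inj₂ (inj₂ (inj₁ e)) = ≢⇒≉ 1<n 3<n (λ ()) (≈-trans (≈-sym last+2≈1) e)
    ... | inj₂ (inj₂ (inj₂ e)) = c≢small (s≤s (s≤s (s≤s (s≤s (s≤s z≤n))))) (≈⇒≡ c<n 4<n
            (≈-trans (≈-sym (+-congʳ c last+1≈0)) (≈-trans (≈-reflexive (xy∙z≈xz∙y last 1 c)) (+-congʳ 1 e))))

    v₃≁v₀ : ¬ Adj (V 3) (V 0)
    v₃≁v₀ a with adjVV⁻¹ a
    ... | inj₁ e = ≢⇒≉ 3+c<n 0<n (λ ()) e
    ... | inj₂ e = c≢small (s≤s (s≤s (s≤s (s≤s z≤n)))) (≈⇒≡ c<n 3<n e)

    v₃≁v_c : ¬ Adj (V 3) (V c)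
    v₃≁v_c a with adjVV⁻¹ a
    ... | inj₁ e = ≢⇒≉ 3<n 0<n (λ ()) (+-cancelʳ c e)
    ... | inj₂ e = ≢⇒≉ 2<n 3<n (λ ()) (≈-trans (≈-sym c+c≈2) e)

    v₁₊c≁u_last : ¬ Adj (V (1 + c)) (U last)
    v₁₊c≁u_last a with adjUV⁻¹ (adj-sym {V (1 + c)} {U last} a)
    ... | inj₁ e = ≢⇒≉ 0<n 2+c<n (λ ())
            (≈-trans (≈-sym last+1≈0) (≈-trans (+-congʳ 1 e) (≈-reflexive (cong suc (+-comm c 1)))))
    ... | inj₂ (inj₁ e) = ≢⇒≉ 0<n 1+c<n (λ ()) (≈-trans (≈-sym last+1≈0) e)
    ... | inj₂ (inj₂ (inj₁ e)) =
      c≢small (s≤s z≤n) (≈⇒≡ c<n 0<n (≈-sym (+-cancelˡ 1 (≈-trans (≈-sym last+2≈1) e))))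
    ... | inj₂ (inj₂ (inj₂ e)) = ≢⇒≉ 0<n 2<n (λ ()) (≈-trans (≈-sym last+1≈0) (+-congʳ 1 (+-cancelʳ c e)))

    v₁₊c≁v₀ : ¬ Adj (V (1 + c)) (V 0)
    v₁₊c≁v₀ a with adjVV⁻¹ a
    ... | inj₁ e = ≢⇒≉ 3<n 0<n (λ ()) (≈-trans (+-congˡ 1 (≈-sym c+c≈2)) e)
    ... | inj₂ e = ≢⇒≉ 0<n 1<n (λ ()) (+-cancelʳ c e)

    v₁₊c≁v_c : ¬ Adj (V (1 + c)) (V c)
    v₁₊c≁v_c a with adjVV⁻¹ a
    ... | inj₁ e = ≢⇒≉ 1+c<n 0<n (λ ()) (+-cancelʳ c e)
    ... | inj₂ e = c≢small (s≤s (s≤s z≤n)) (≈⇒≡ c<n 1<n (+-cancelʳ c e))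

  u₀u₁-not-onInducedSquare : ¬ OnInducedSquare Adj (U 0) (U 1)
  u₀u₁-not-onInducedSquare (a , b , u₁a , ab , bu₀ , u₀≁a , u₁≁b , a≢u₀ , b≢u₁)
    with opposite-u₁ a u₁a u₀≁a a≢u₀ | opposite-u₀ b bu₀ u₁≁b b≢u₁
  ... | inj₁ refl | inj₁ refl = u₂≁u_last ab
  ... | inj₁ refl | inj₂ (inj₁ refl) = u₂≁v₀ ab
  ... | inj₁ refl | inj₂ (inj₂ refl) = u₂≁v_c ab
  ... | inj₂ (inj₁ refl) | inj₁ refl = v₃≁u_last ab
  ... | inj₂ (inj₁ refl) | inj₂ (inj₁ refl) = v₃≁v₀ ab
  ... | inj₂ (inj₁ refl) | inj₂ (inj₂ refl) = v₃≁v_c ab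
  ... | inj₂ (inj₂ refl) | inj₁ refl = v₁₊c≁u_last ab
  ... | inj₂ (inj₂ refl) | inj₂ (inj₁ refl) = v₁₊c≁v₀ ab
  ... | inj₂ (inj₂ refl) | inj₂ (inj₂ refl) = v₁₊c≁v_c ab

  not-edgeTransitive : ¬ EdgeTransitive Adj
  not-edgeTransitive et = u₀u₁-not-onInducedSquare
    (onInducedSquare-edgeTransitive (λ {x} {y} → adj-sym {x} {y}) et (adjUVᵃ ≈-refl) (adjUU (inj₁ ≈-refl))
      u₀v₁-onInducedSquare)

-- Finite checks: N(8;1,2,5;3) and N(6;1,2,4;4)

module _ {n : ℕ} where

  ∀-Vtx? : {P : Vtx n → Set} → (∀ x → Dec (P x)) → Dec (∀ x → P x)
  ∀-Vtx? {P} P? = map′ combine (λ p → p ∘ u , p ∘ v) (Fin.all? (P? ∘ u) ×-dec Fin.all? (P? ∘ v))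
    where
    combine : (∀ i → P (u i)) × (∀ i → P (v i)) → ∀ x → P x
    combine (pu , pv) (u i) = pu i
    combine (pu , pv) (v i) = pv i

  infix 4 _≟ⱽ_
  _≟ⱽ_ : DecidableEquality (Vtx n)
  u i ≟ⱽ u j = map′ (cong u) (λ { refl → refl }) (i Fin.≟ j)
  v i ≟ⱽ v j = map′ (cong v) (λ { refl → refl }) (i Fin.≟ j)
  u i ≟ⱽ v j = no λ ()
  v i ≟ⱽ u j = no λ ()

module _ {n : ℕ} {A : Vtx n → Vtx n → Set} (adjacent? : ∀ x y → Dec (A x y)) where

  involutiveAutomorphism? : ∀ f → Dec (InvolutiveAutomorphism A f)
  involutiveAutomorphism? f =
    ∀-Vtx? (λ x → f (f x) ≟ⱽ x) ×-dec ∀-Vtx? λ x → ∀-Vtx? λ y → adjacent? x y →-dec adjacent? (f x) (f y)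

tabulated : ∀ {n} → Vec (Vtx n) n → Vec (Vtx n) n → Vtx n → Vtx n
tabulated us vs (u i) = lookup us i
tabulated us vs (v i) = lookup vs i

module Nest8 where
  open Nest 8 1 2 5 3

  -- u_i ↦ u_{b-i}, v_i ↦ v_{b+2-i}, as -1 ≡ 7 (mod 8).
  reflection : Fin 8 → Vtx 8 → Vtx 8
  reflection b (u i) = U (toℕ b + 7 * toℕ i)
  reflection b (v i) = V (toℕ b + 2 + 7 * toℕ i)

  swap : Vtx 8 → Vtx 8
  swap (u i) = V (3 * toℕ i)
  swap (v i) = U (3 * toℕ i)

  reflectionᴬ : Fin 8 → Automorphism Adj
  reflectionᴬ b = involutive-automorphism (reflection b)
    (from-yes (Fin.all? λ b → involutiveAutomorphism? adjacent? (reflection b)) b)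

  swapᴬ : Automorphism Adj
  swapᴬ = involutive-automorphism swap (from-yes (involutiveAutomorphism? adjacent? swap))

  -- Involutions fixing u₀ and sending u₁ to v₀, resp. v₁ (found by a computer search).
  τ₀ τ₁ : Automorphism Adj
  τ₀ = involutive-automorphism f (from-yes (involutiveAutomorphism? adjacent? f))
    where f = tabulated (U 0 ∷ V 0 ∷ U 6 ∷ V 6 ∷ U 4 ∷ V 4 ∷ U 2 ∷ V 2 ∷ [])
                        (U 1 ∷ V 5 ∷ U 7 ∷ V 3 ∷ U 5 ∷ V 1 ∷ U 3 ∷ V 7 ∷ [])
  τ₁ = involutive-automorphism f (from-yes (involutiveAutomorphism? adjacent? f))
    where f = tabulated (U 0 ∷ V 1 ∷ V 4 ∷ U 3 ∷ V 3 ∷ U 6 ∷ U 5 ∷ V 2 ∷ [])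
                        (V 5 ∷ U 1 ∷ U 7 ∷ U 4 ∷ U 2 ∷ V 0 ∷ V 6 ∷ V 7 ∷ [])

  vertex-images : ∀ x → ∃[ b ] (reflection b (U 0) ≡ x ⊎ swap (reflection b (U 0)) ≡ x)
  vertex-images = from-yes (∀-Vtx? λ x → Fin.any? λ b →
    reflection b (U 0) ≟ⱽ x ⊎-dec swap (reflection b (U 0)) ≟ⱽ x)

  vertex-transitive : ∀ x → ∃[ σ ] apply σ (U 0) ≡ x
  vertex-transitive x with vertex-images x
  ... | b , inj₁ e = reflectionᴬ b , e
  ... | b , inj₂ e = swapᴬ ∘ᴬ reflectionᴬ b , e

  -- They send u₁ to the six neighbours u₁, u₇, v₀, v₂, v₁, v₅ of u₀.
  stabiliser : Vec (Automorphism Adj) 6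
  stabiliser =
    identityᴬ ∷ reflectionᴬ Fin.zero ∷ τ₀ ∷ reflectionᴬ Fin.zero ∘ᴬ τ₀ ∷ τ₁ ∷ τ₀ ∘ᴬ τ₁ ∷ []

  stabiliser-images : ∀ y → Adj (U 0) y →
    ∃[ j ] (apply (lookup stabiliser j) (U 0) ≡ U 0 × apply (lookup stabiliser j) (U 1) ≡ y)
  stabiliser-images = from-yes (∀-Vtx? λ y → adjacent? (U 0) y →-dec Fin.any? λ j →
    apply (lookup stabiliser j) (U 0) ≟ⱽ U 0 ×-dec apply (lookup stabiliser j) (U 1) ≟ⱽ y)

  -- Projections rather than `with`: abstracting over stabiliser-images y u₀y makes Agda
  -- normalise the proof term of the decision procedure, which exhausts memory.
  stabiliser-transitive : ∀ y → Adj (U 0) y → ∃[ τ ] (apply τ (U 0) ≡ U 0 × apply τ (U 1) ≡ y)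
  stabiliser-transitive y u₀y = lookup stabiliser (proj₁ images) , proj₂ images
    where images = stabiliser-images y u₀y

  arcTransitive : ArcTransitive Adj
  arcTransitive = arcTransitive-from-stabiliser (U 0) (U 1) vertex-transitive stabiliser-transitive

  u₀u₁-onExactlyTwoTriangles : OnExactlyTwoTriangles Adj (U 0) (U 1)
  u₀u₁-onExactlyTwoTriangles =
    V 1 , V 2 , (λ ()) , edge (U 0) (V 1) , edge (U 1) (V 1) , edge (U 0) (V 2) , edge (U 1) (V 2) ,
    from-yes (∀-Vtx? λ z → adjacent? (U 0) z →-dec adjacent? (U 1) z →-dec (z ≟ⱽ V 1 ⊎-dec z ≟ⱽ V 2))

  everyEdgeOnExactlyTwoTriangles : EveryEdgeOnExactlyTwoTriangles Adj
  everyEdgeOnExactlyTwoTriangles =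
    everyEdgeOnExactlyTwoTriangles-from-arcTransitive arcTransitive (edge (U 0) (U 1)) u₀u₁-onExactlyTwoTriangles

module Nest6 where
  open Nest 6 1 2 4 4

  not-everyEdgeOnExactlyTwoTriangles : ¬ EveryEdgeOnExactlyTwoTriangles Adj
  not-everyEdgeOnExactlyTwoTriangles two = no-third-common-neighbour Adj (two (U 0) (V 0) (edge (U 0) (V 0)))
    (edge (U 0) (V 4)) (edge (V 0) (V 4)) (edge (U 0) (U 5)) (edge (V 0) (U 5)) (edge (U 0) (V 2)) (edge (V 0) (V 2))
    (λ ()) (λ ()) (λ ())

-- The classification

diagonal⇒c≡5 : ∀ n .{{_ : NonZero n}} c → 4 ≤ c → c + c ≡ 2 + n →
  EdgeTransitive (NestAdj n 1 2 c c) → EveryEdgeOnExactlyTwoTriangles (NestAdj n 1 2 c c) → c ≡ 5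
diagonal⇒c≡5 _ 1 (s≤s ()) _ _ _
diagonal⇒c≡5 _ 2 (s≤s (s≤s ())) _ _ _
diagonal⇒c≡5 _ 3 (s≤s (s≤s (s≤s ()))) _ _ _
diagonal⇒c≡5 .6 4 _ refl _ two = contradiction two Nest6.not-everyEdgeOnExactlyTwoTriangles
diagonal⇒c≡5 .8 5 _ refl _ _ = refl
diagonal⇒c≡5 n c@(suc (suc (suc (suc (suc (suc _)))))) _ c+c≡2+n et _ =
  contradiction et (InducedSquares.not-edgeTransitive n c (s≤s (s≤s (s≤s (s≤s (s≤s (s≤s z≤n)))))) c+c≡2+n)

isomorphic-to-N₈ : ∀ {n c k} → c ≡ 5 → c + c ≡ 2 + n → k ≡ c ⊎ c + k ≡ n →
  Isomorphic (NestAdj n 1 2 c k) (NestAdj 8 1 2 5 3)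
isomorphic-to-N₈ refl refl (inj₁ refl) = isomorphic-of-⇔ (nestAdj-complement refl)
isomorphic-to-N₈ refl refl (inj₂ refl) = isomorphic-of-⇔ λ _ _ → ⇔.refl

edgeTransitive×twoTriangles⇒isomorphic : ∀ n .{{_ : NonZero n}} c k →
  4 ≤ n → 3 ≤ c → c < n → 1 ≤ k → k < n →
  EdgeTransitive (NestAdj n 1 2 c k) × EveryEdgeOnExactlyTwoTriangles (NestAdj n 1 2 c k) →
  Isomorphic (NestAdj n 1 2 c k) (NestAdj 8 1 2 5 3)
edgeTransitive×twoTriangles⇒isomorphic n c k 4≤n 3≤c c<n 1≤k k<n (et , two) =
  isomorphic-to-N₈ c≡5 c+c≡2+n k≡c⊎c+k≡n
  where
  open TwoTriangles n c k 4≤n 3≤c c<n 1≤k k<n two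
  c≡5 : c ≡ 5
  c≡5 with k≡c⊎c+k≡n
  ... | inj₁ refl = diagonal⇒c≡5 n c 4≤c c+c≡2+n et two
  ... | inj₂ c+k≡n = diagonal⇒c≡5 n c 4≤c c+c≡2+n
                       (edgeTransitive-pullback ι et) (everyEdgeOnExactlyTwoTriangles-pullback ι two)
    where ι = isomorphic-of-⇔ (nestAdj-complement c+k≡n)

isomorphic⇒edgeTransitive×twoTriangles : ∀ {V : Set} {A : V → V → Set} → Isomorphic A (NestAdj 8 1 2 5 3) →
  EdgeTransitive A × EveryEdgeOnExactlyTwoTriangles A
isomorphic⇒edgeTransitive×twoTriangles ι =
  edgeTransitive-pullback ι (arcTransitive⇒edgeTransitive Nest8.arcTransitive) ,
  everyEdgeOnExactlyTwoTriangles-pullback ι Nest8.everyEdgeOnExactlyTwoTriangles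

-- The hypothesis 2k ≢ n is unused: adjacency is a relation here, so the degenerate
-- case k = n/2 (where v_i v_{i+k} and v_{i+k} v_{i+2k} coincide) needs no special treatment.
lemma4p2 : (n c k : ℕ) → 4 ≤ n → 3 ≤ c → c < n → 1 ≤ k → k < n → ¬ (2 * k ≡ n) →
    ((EdgeTransitive (NestAdj n 1 2 c k) × EveryEdgeOnExactlyTwoTriangles (NestAdj n 1 2 c k))
      ⇔ Isomorphic (NestAdj n 1 2 c k) (NestAdj 8 1 2 5 3))
    × ArcTransitive (NestAdj 8 1 2 5 3)
lemma4p2 n@(suc _) c k 4≤n 3≤c c<n 1≤k k<n _ =
  mk⇔ (edgeTransitive×twoTriangles⇒isomorphic n c k 4≤n 3≤c c<n 1≤k k<n)
      isomorphic⇒edgeTransitive×twoTriangles ,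
  Nest8.arcTransitive
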